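{- Let $\phi$ be a consistent formula of $\mathbf{PT}$ whose propositional variables are among $p_1,\dots,p_n$. The following are equivalent: (i) $\phi$ is flat; (ii) $\phi\equiv\Theta_X$ for some nonempty team $X$ on $\{p_1,\dots,p_n\}$; (iii) $\phi\equiv\neg\neg\phi$; (iv) $\models\phi\otimes\neg\phi$.
   Context: A valuation is a function $v:\mathrm{Prop}\to\{0,1\}$; a team is a set of valuations; a team on a set $V$ of variables is a set of functions $V\to\{0,1\}$. Formulas of $\mathbf{PT}$: $\phi::=p\mid\bot\mid\top\mid {=}(\phi,\dots,\phi,\phi)\mid\neg\phi\mid\phi\wedge\phi\mid\phi\otimes\phi\mid\phi\vee\phi\mid\phi\to\phi$. Team semantics: $X\models p$ iff $v(p)=1$ for all $v\in X$; $X\models\bot$ iff $X=\emptyset$; $X\models\top$ always; $X\models\phi\wedge\psi$ iff both; $X\models\phi\otimes\psi$ iff $X=Y\cup Z$ for some $Y,Z\subseteq X$ with $Y\models\phi$, $Z\models\psi$; $X\models\phi\vee\psi$ iff $X\models\phi$ or $X\models\psi$; $X\models\phi\to\psi$ iff every $Y\subseteq X$ with $Y\models\phi$ satisfies $Y\models\psi$; $X\models\neg\phi$ iff $\{v\}\not\models\phi$ for all $v\in X$; $X\models{=}(\phi_1,\dots,\phi_n,\psi)$ iff $X\models\bigwedge_{i=1}^n(\phi_i\vee\neg\phi_i)\to(\psi\vee\neg\psi)$ (satisfaction depends only on restrictions of valuations to the variables of the formula). $\phi$ is flat if for every team $X$: $X\models\phi$ iff $\{v\}\models\phi$ for all $v\in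 X$. $\phi\equiv\psi$ means every team satisfies $\phi$ iff it satisfies $\psi$; $\models\phi$ means every team satisfies $\phi$; $\phi$ is consistent if it is not equivalent to $\bot$ (some nonempty team satisfies it). For a nonempty team $X$ on $\{p_1,\dots,p_n\}$, $\Theta_X:=\neg\neg\bigvee_{v\in X}(p_1^{v(p_1)}\wedge\dots\wedge p_n^{v(p_n)})$, where $p^1:=p$ and $p^0:=\neg p$. -}

module Defs where

open import Data.Nat using (ℕ; zero; suc)
open import Data.Fin using (Fin)
open import Data.Bool using (Bool; true; false)
open import Data.Bool.Properties using () renaming (_≟_ to _≟ᵇ_)
open import Data.Vec using (Vec; []; _∷_; lookup)
open import Data.Vec.Properties using (≡-dec)
open import Data.List using (List; []; _∷_; map; _++_; filterᵇ)
open import Data.Product using (Σ; _×_; _,_; ∃)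
open import Data.Sum using (_⊎_)
open import Data.Unit using (⊤)
open import Data.Empty using (⊥)
open import Relation.Nullary using (¬_; does)
open import Relation.Binary.PropositionalEquality using (_≡_)
open import Function.Bundles using (_⇔_)

-- Valuations on the variables {p_0,...,p_{n-1}} (= p_1..p_n of the paper)
Val : ℕ → Set
Val n = Vec Bool n

-- A team on {p_1..p_n}: a (necessarily finite) set of valuations, as a characteristic function
Team : ℕ → Set
Team n = Val n → Bool

_∈_ : ∀ {n} → Val n → Team n → Set
v ∈ X = X v ≡ true

_⊆_ : ∀ {n} → Team n → Team n → Set
Y ⊆ X = ∀ v → v ∈ Y → v ∈ X

single : ∀ {n} → Val n → Team n
single v w = does (≡-dec _≟ᵇ_ w v)

NonEmpty : ∀ {n} → Team n → Set
NonEmpty X = ∃ λ v → v ∈ X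

data Form (n : ℕ) : Set where
  var  : Fin n → Form n
  bot  : Form n
  top  : Form n
  dep  : List (Form n) → Form n → Form n
  neg  : Form n → Form n
  _∧'_ : Form n → Form n → Form n
  _⊗_  : Form n → Form n → Form n
  _∨'_ : Form n → Form n → Form n
  _⇒_  : Form n → Form n → Form n

mutual
  _⊨_ : ∀ {n} → Team n → Form n → Set
  X ⊨ var i = ∀ v → v ∈ X → lookup v i ≡ true
  X ⊨ bot = ∀ v → X v ≡ false
  X ⊨ top = ⊤
  X ⊨ dep φs ψ = ∀ Y → Y ⊆ X → DepAnt Y φs → (Y ⊨ ψ) ⊎ NegSat Y ψ
  X ⊨ neg φ = NegSat X φ
  X ⊨ (φ ∧' ψ) = (X ⊨ φ) × (X ⊨ ψ)
  X ⊨ (φ ⊗ ψ) = Σ (Team _) λ Y → Σ (Team _) λ Z →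
                  (Y ⊆ X) × (Z ⊆ X) × (∀ v → v ∈ X → (v ∈ Y) ⊎ (v ∈ Z))
                  × (Y ⊨ φ) × (Z ⊨ ψ)
  X ⊨ (φ ∨' ψ) = (X ⊨ φ) ⊎ (X ⊨ ψ)
  X ⊨ (φ ⇒ ψ) = ∀ Y → Y ⊆ X → Y ⊨ φ → Y ⊨ ψ

  -- X ⊨ ¬φ (unfolded, for termination)
  NegSat : ∀ {n} → Team n → Form n → Set
  NegSat X φ = ∀ v → v ∈ X → ¬ (single v ⊨ φ)

  -- Y ⊨ ⋀_i (φ_i ∨ ¬φ_i)  (empty conjunction = ⊤)
  DepAnt : ∀ {n} → Team n → List (Form n) → Set
  DepAnt Y [] = ⊤
  DepAnt Y (φ ∷ φs) = ((Y ⊨ φ) ⊎ NegSat Y φ) × DepAnt Y φs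

Flat : ∀ {n} → Form n → Set
Flat {n} φ = ∀ (X : Team n) → (X ⊨ φ) ⇔ (∀ v → v ∈ X → single v ⊨ φ)

_≡ᶠ_ : ∀ {n} → Form n → Form n → Set
_≡ᶠ_ {n} φ ψ = ∀ (X : Team n) → (X ⊨ φ) ⇔ (X ⊨ ψ)

Valid : ∀ {n} → Form n → Set
Valid {n} φ = ∀ (X : Team n) → X ⊨ φ

Consistent : ∀ {n} → Form n → Set
Consistent φ = ¬ (φ ≡ᶠ bot)

allVals : ∀ n → List (Val n)
allVals zero = [] ∷ []
allVals (suc n) = map (true ∷_) (allVals n) ++ map (false ∷_) (allVals n)

lit : ∀ {n} → Fin n → Bool → Form n
lit i true = var i
lit i false = neg (var i)

bigAnd : ∀ {n} → List (Form n) → Form n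
bigAnd [] = top
bigAnd (φ ∷ φs) = φ ∧' bigAnd φs

bigOr : ∀ {n} → List (Form n) → Form n
bigOr [] = bot
bigOr (φ ∷ []) = φ
bigOr (φ ∷ φs) = φ ∨' bigOr φs

charConj : ∀ {n} → Val n → Form n
charConj {n} v = bigAnd (map (λ i → lit i (lookup v i)) (Data.List.allFin n))

Θ : ∀ {n} → Team n → Form n
Θ {n} X = neg (neg (bigOr (map charConj (filterᵇ X (allVals n)))))

-- Every PT formula is downward closed and true on the empty team, and whether a singleton
-- {v} satisfies it is decidable; in particular φ and ¬¬φ agree on singletons. Flat formulas
-- that agree on singletons are equivalent, so a flat φ is determined by the team ⟦ φ ⟧ of
-- valuations v with {v} ⊨ φ: this gives φ ≡ Θ ⟦ φ ⟧ and φ ≡ ¬¬φ, and every team splits into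
-- its part inside ⟦ φ ⟧, satisfying φ, and its part outside, satisfying ¬φ. Conversely,
-- negations are flat, which covers Θ X and ¬¬φ; and if X = Y ∪ Z with Y ⊨ φ and Z ⊨ ¬φ
-- while every singleton of X satisfies φ, then no valuation of X lies in Z, so X ⊆ Y.
-- Consistency of a flat φ is exactly what makes ⟦ φ ⟧ nonempty.
module Submission where

open import Defs
open import Data.Nat using (ℕ; suc)
open import Data.Fin using (Fin)
open import Data.Bool using (true; false; _∧_; not; T?)
open import Data.Bool.Properties
  using (∧-conicalˡ; ∧-conicalʳ; ¬-not; not-¬; T-≡) renaming (_≟_ to _≟ᵇ_)
open import Data.Vec using ([]; _∷_; lookup)
open import Data.Vec.Properties using (≡-dec)
open import Data.Vec.Relation.Binary.Pointwise.Extensional using (ext; Pointwise-≡⇒≡)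
open import Data.List using (List; []; _∷_; map; filterᵇ; allFin)
open import Data.List.Relation.Unary.All as All using (All; []; _∷_)
open import Data.List.Relation.Unary.Any as Any using (Any; here; there; any?)
import Data.List.Relation.Unary.All.Properties as All
import Data.List.Relation.Unary.Any.Properties as Any
open import Data.List.Membership.Propositional using (lose) renaming (_∈_ to _∈ₗ_)
open import Data.List.Membership.Propositional.Properties
  using (∈-allFin; ∈-map⁺; ∈-++⁺ˡ; ∈-++⁺ʳ; ∈-filter⁺; ∈-filter⁻)
open import Data.Product using (_×_; ∃; _,_; proj₂)
open import Data.Sum using (_⊎_; inj₁; inj₂; [_,_])
open import Data.Unit using (tt)
open import Data.Empty using (⊥-elim)
open import Function using (_∘_; id; case_of_)
open import Function.Properties.Equivalence using () renaming (sym to ⇔-sym; trans to ⇔-trans)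
open import Function.Bundles using (_⇔_; mk⇔; Equivalence)
open import Function.Related.Propositional using (module EquationalReasoning)
open import Relation.Nullary using (¬_; Dec; yes; no; does; contradiction)
open import Relation.Nullary.Decidable
  using (map′; _×-dec_; _⊎-dec_; _→-dec_; ¬?; decidable-stable; dec-true)
open import Relation.Binary.PropositionalEquality using (_≡_; refl; sym; subst; cong; cong₂)

open Equivalence

private
  variable
    n : ℕ
    φ ψ : Form n
    X Y : Team n
    v : Val n

_∩_ : Team n → Team n → Team n
(X ∩ Y) v = X v ∧ Y v

_∖_ : Team n → Team n → Team n
(X ∖ Y) v = X v ∧ not (Y v)

∩-⊆ˡ : ∀ (X Y : Team n) → (X ∩ Y) ⊆ X
∩-⊆ˡ X Y v = ∧-conicalˡ (X v) (Y v)

∩-⊆ʳ : ∀ (X Y : Team n) → (X ∩ Y) ⊆ Y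
∩-⊆ʳ X Y v = ∧-conicalʳ (X v) (Y v)

∈-∩⁺ : ∀ (X Y : Team n) → v ∈ X → v ∈ Y → v ∈ (X ∩ Y)
∈-∩⁺ X Y = cong₂ _∧_

∖-⊆ : ∀ (X Y : Team n) → (X ∖ Y) ⊆ X
∖-⊆ X Y v = ∧-conicalˡ (X v) (not (Y v))

∈-∖⁻ : ∀ (X Y : Team n) → v ∈ (X ∖ Y) → ¬ v ∈ Y
∈-∖⁻ {v = v} X Y v∈ v∈Y = not-¬ (cong not v∈Y) (∧-conicalʳ (X v) (not (Y v)) v∈)

∈-∩⊎∈-∖ : ∀ (X Y : Team n) v → v ∈ X → v ∈ (X ∩ Y) ⊎ v ∈ (X ∖ Y)
∈-∩⊎∈-∖ X Y v v∈ with Y v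
... | true  = inj₁ (cong (_∧ true) v∈)
... | false = inj₂ (cong (_∧ true) v∈)

∈-single : ∀ (v : Val n) → v ∈ single v
∈-single v = dec-true (≡-dec _≟ᵇ_ v v) refl

∈-single⁻ : ∀ w (v : Val n) → w ∈ single v → w ≡ v
∈-single⁻ w v w∈ with ≡-dec _≟ᵇ_ w v | w∈
... | yes w≡v | _ = w≡v
... | no _    | ()

single-⊆ : ∀ (X : Team n) v → v ∈ X → single v ⊆ X
single-⊆ X v v∈ w w∈ = subst (_∈ X) (sym (∈-single⁻ w v w∈)) v∈

⊆-single : Y ⊆ single v → single v ⊆ Y ⊎ (∀ w → Y w ≡ false)
⊆-single {Y = Y} {v = v} Y⊆ with Y v in eq
... | true  = inj₁ (single-⊆ Y v eq)
... | false = inj₂ λ w → ¬-not λ w∈ → not-¬ (subst (λ u → u ∈ Y) (∈-single⁻ w v (Y⊆ w w∈)) w∈) eq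

downward-closed : ∀ (φ : Form n) → Y ⊆ X → X ⊨ φ → Y ⊨ φ
downward-closed (var i) Y⊆ h v v∈ = h v (Y⊆ v v∈)
downward-closed {Y = Y} bot Y⊆ h v = ¬-not λ v∈ → not-¬ (Y⊆ v v∈) (h v)
downward-closed top Y⊆ h = tt
downward-closed (dep φs ψ) Y⊆ h Z Z⊆ = h Z λ v v∈ → Y⊆ v (Z⊆ v v∈)
downward-closed (neg φ) Y⊆ h v v∈ = h v (Y⊆ v v∈)
downward-closed (φ ∧' ψ) Y⊆ (hφ , hψ) = downward-closed φ Y⊆ hφ , downward-closed ψ Y⊆ hψ
downward-closed {Y = Y} (φ ⊗ ψ) Y⊆ (Z₁ , Z₂ , _ , _ , cover , h₁ , h₂) =
  Z₁ ∩ Y , Z₂ ∩ Y , ∩-⊆ʳ Z₁ Y , ∩-⊆ʳ Z₂ Y ,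
  (λ v v∈ → [ inj₁ ∘ (λ p → ∈-∩⁺ Z₁ Y p v∈) , inj₂ ∘ (λ p → ∈-∩⁺ Z₂ Y p v∈) ] (cover v (Y⊆ v v∈))) ,
  downward-closed φ (∩-⊆ˡ Z₁ Y) h₁ , downward-closed ψ (∩-⊆ˡ Z₂ Y) h₂
downward-closed (φ ∨' ψ) Y⊆ (inj₁ h) = inj₁ (downward-closed φ Y⊆ h)
downward-closed (φ ∨' ψ) Y⊆ (inj₂ h) = inj₂ (downward-closed ψ Y⊆ h)
downward-closed (φ ⇒ ψ) Y⊆ h Z Z⊆ = h Z λ v v∈ → Y⊆ v (Z⊆ v v∈)

⊆-empty : Y ⊆ X → (∀ v → X v ≡ false) → ∀ v → Y v ≡ false
⊆-empty Y⊆ ∅ v = ¬-not λ v∈ → not-¬ (Y⊆ v v∈) (∅ v)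

empty-⊨ : ∀ (φ : Form n) → (∀ v → X v ≡ false) → X ⊨ φ
empty-⊨ (var i) ∅ v v∈ = contradiction (∅ v) (not-¬ v∈)
empty-⊨ bot ∅ = ∅
empty-⊨ top ∅ = tt
empty-⊨ (dep φs ψ) ∅ Y Y⊆ _ = inj₁ (empty-⊨ ψ (⊆-empty Y⊆ ∅))
empty-⊨ (neg φ) ∅ v v∈ = contradiction (∅ v) (not-¬ v∈)
empty-⊨ (φ ∧' ψ) ∅ = empty-⊨ φ ∅ , empty-⊨ ψ ∅
empty-⊨ {X = X} (φ ⊗ ψ) ∅ =
  X , X , (λ _ → id) , (λ _ → id) , (λ _ → inj₁) , empty-⊨ φ ∅ , empty-⊨ ψ ∅
empty-⊨ (φ ∨' ψ) ∅ = inj₁ (empty-⊨ φ ∅)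
empty-⊨ (φ ⇒ ψ) ∅ Y Y⊆ _ = empty-⊨ ψ (⊆-empty Y⊆ ∅)

single-⊨-var : ∀ {i : Fin n} → (single v ⊨ var i) ⇔ (lookup v i ≡ true)
single-⊨-var {v = v} {i = i} = mk⇔ (λ h → h v (∈-single v))
  (λ p w w∈ → subst (λ u → lookup u i ≡ true) (sym (∈-single⁻ w v w∈)) p)

single-⊨-neg : (single v ⊨ neg φ) ⇔ (¬ single v ⊨ φ)
single-⊨-neg {v = v} {φ = φ} = mk⇔ (λ h → h v (∈-single v))
  (λ ¬h w w∈ → ¬h ∘ subst (λ u → single u ⊨ φ) (∈-single⁻ w v w∈))

single-⊨-⊗ : (single v ⊨ (φ ⊗ ψ)) ⇔ ((single v ⊨ φ) ⊎ (single v ⊨ ψ))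
single-⊨-⊗ {v = v} {φ = φ} {ψ = ψ} = mk⇔ split join
  where
  split : single v ⊨ (φ ⊗ ψ) → (single v ⊨ φ) ⊎ (single v ⊨ ψ)
  split (_ , _ , _ , _ , cover , hφ , hψ) =
    [ (λ p → inj₁ (downward-closed φ (single-⊆ _ v p) hφ))
    , (λ p → inj₂ (downward-closed ψ (single-⊆ _ v p) hψ))
    ] (cover v (∈-single v))
  join : (single v ⊨ φ) ⊎ (single v ⊨ ψ) → single v ⊨ (φ ⊗ ψ)
  join (inj₁ p) =
    single v , (λ _ → false) , (λ _ → id) , (λ _ ()) , (λ _ → inj₁) , p , empty-⊨ ψ (λ _ → refl)
  join (inj₂ p) =
    (λ _ → false) , single v , (λ _ ()) , (λ _ → id) , (λ _ → inj₂) , empty-⊨ φ (λ _ → refl) , p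

single-⊨-⇒ : (single v ⊨ (φ ⇒ ψ)) ⇔ (single v ⊨ φ → single v ⊨ ψ)
single-⊨-⇒ {v = v} {φ = φ} {ψ = ψ} = mk⇔ (λ h → h (single v) (λ _ → id)) lift
  where
  lift : (single v ⊨ φ → single v ⊨ ψ) → single v ⊨ (φ ⇒ ψ)
  lift f Y Y⊆ hφ with ⊆-single Y⊆
  ... | inj₁ v⊆Y = downward-closed ψ Y⊆ (f (downward-closed φ v⊆Y hφ))
  ... | inj₂ ∅   = empty-⊨ ψ ∅

single-⊨-dep : ∀ {φs} → Dec (single v ⊨ ψ) → single v ⊨ dep φs ψ
single-⊨-dep {ψ = ψ} (yes p) Y Y⊆ _ = inj₁ (downward-closed ψ Y⊆ p)
single-⊨-dep {v = v} {ψ = ψ} (no ¬p) Y Y⊆ _ =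
  inj₂ λ w w∈ → ¬p ∘ subst (λ u → single u ⊨ ψ) (∈-single⁻ w v (Y⊆ w w∈))

single-⊨? : ∀ (φ : Form n) v → Dec (single v ⊨ φ)
single-⊨? (var i) v = map′ (from single-⊨-var) (to single-⊨-var) (lookup v i ≟ᵇ true)
single-⊨? bot v = no λ h → not-¬ (∈-single v) (h v)
single-⊨? top v = yes tt
single-⊨? (dep φs ψ) v = yes (single-⊨-dep (single-⊨? ψ v))
single-⊨? (neg φ) v = map′ (from single-⊨-neg) (to single-⊨-neg) (¬? (single-⊨? φ v))
single-⊨? (φ ∧' ψ) v = single-⊨? φ v ×-dec single-⊨? ψ v
single-⊨? (φ ⊗ ψ) v = map′ (from single-⊨-⊗) (to single-⊨-⊗) (single-⊨? φ v ⊎-dec single-⊨? ψ v)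
single-⊨? (φ ∨' ψ) v = single-⊨? φ v ⊎-dec single-⊨? ψ v
single-⊨? (φ ⇒ ψ) v = map′ (from single-⊨-⇒) (to single-⊨-⇒) (single-⊨? φ v →-dec single-⊨? ψ v)

single-⊨-neg-neg : (single v ⊨ neg (neg φ)) ⇔ (single v ⊨ φ)
single-⊨-neg-neg {v = v} {φ = φ} = mk⇔
  (λ h → decidable-stable (single-⊨? φ v)
            (to (single-⊨-neg {φ = neg φ}) h ∘ from (single-⊨-neg {φ = φ})))
  (λ p → from (single-⊨-neg {φ = neg φ}) (λ h → to (single-⊨-neg {φ = φ}) h p))

⟦_⟧ : Form n → Team n
⟦ φ ⟧ v = does (single-⊨? φ v)

∈-⟦⟧ : (v ∈ ⟦ φ ⟧) ⇔ (single v ⊨ φ)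
∈-⟦⟧ {v = v} {φ = φ} = mk⇔ (satisfied (single-⊨? φ v)) (dec-true (single-⊨? φ v))
  where
  satisfied : ∀ {P : Set} (P? : Dec P) → does P? ≡ true → P
  satisfied (yes p) _ = p

flat-from-singletons : (∀ (X : Team n) → (∀ v → v ∈ X → single v ⊨ φ) → X ⊨ φ) → Flat φ
flat-from-singletons {φ = φ} lift X =
  mk⇔ (λ h v v∈ → downward-closed φ (single-⊆ X v v∈) h) (lift X)

neg-flat : Flat (neg φ)
neg-flat {φ = φ} = flat-from-singletons {φ = neg φ} λ X h v v∈ → to (single-⊨-neg {φ = φ}) (h v v∈)

flat-resp-≡ᶠ : φ ≡ᶠ ψ → Flat ψ → Flat φ
flat-resp-≡ᶠ φ≡ψ ψ-flat X = mk⇔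
  (λ h v v∈ → from (φ≡ψ (single v)) (to (ψ-flat X) (to (φ≡ψ X) h) v v∈))
  (λ h → from (φ≡ψ X) (from (ψ-flat X) λ v v∈ → to (φ≡ψ (single v)) (h v v∈)))

flat-≡ᶠ : Flat φ → Flat ψ → (∀ v → (single v ⊨ φ) ⇔ (single v ⊨ ψ)) → φ ≡ᶠ ψ
flat-≡ᶠ φ-flat ψ-flat agree X = mk⇔
  (λ h → from (ψ-flat X) λ v v∈ → to (agree v) (to (φ-flat X) h v v∈))
  (λ h → from (φ-flat X) λ v v∈ → from (agree v) (to (ψ-flat X) h v v∈))

allVals-complete : ∀ (v : Val n) → v ∈ₗ allVals n
allVals-complete [] = here refl
allVals-complete {suc n} (true ∷ v) = ∈-++⁺ˡ (∈-map⁺ (true ∷_) (allVals-complete v))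
allVals-complete {suc n} (false ∷ v) =
  ∈-++⁺ʳ (map (true ∷_) (allVals n)) (∈-map⁺ (false ∷_) (allVals-complete v))

∈-filterᵇ-allVals : (v ∈ₗ filterᵇ X (allVals n)) ⇔ (v ∈ X)
∈-filterᵇ-allVals {n} {v = v} {X = X} = mk⇔
  (to T-≡ ∘ proj₂ ∘ ∈-filter⁻ (T? ∘ X) {xs = allVals n})
  (∈-filter⁺ (T? ∘ X) (allVals-complete v) ∘ from T-≡)

⊨-bigAnd : ∀ {φs : List (Form n)} → (X ⊨ bigAnd φs) ⇔ All (X ⊨_) φs
⊨-bigAnd {φs = []} = mk⇔ (λ _ → []) (λ _ → tt)
⊨-bigAnd {φs = φ ∷ φs} = mk⇔ (λ (h , hs) → h ∷ to ⊨-bigAnd hs) λ { (h ∷ hs) → h , from ⊨-bigAnd hs }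

⊨-bigOr : ∀ {φs : List (Form n)} → NonEmpty X → (X ⊨ bigOr φs) ⇔ Any (X ⊨_) φs
⊨-bigOr {φs = []} (v , v∈) = mk⇔ (λ h → contradiction (h v) (not-¬ v∈)) λ ()
⊨-bigOr {φs = φ ∷ []} _ = mk⇔ here λ { (here h) → h ; (there ()) }
⊨-bigOr {φs = φ ∷ ψ ∷ φs} ne with ⊨-bigOr {φs = ψ ∷ φs} ne
... | rest = mk⇔ [ here , there ∘ to rest ]
                 λ { (here h) → inj₁ h ; (there hs) → inj₂ (from rest hs) }

single-⊨-lit : ∀ {i : Fin n} b → (single v ⊨ lit i b) ⇔ (lookup v i ≡ b)
single-⊨-lit true = single-⊨-var
single-⊨-lit {v = v} {i = i} false = mk⇔
  (λ h → ¬-not (to (single-⊨-neg {φ = var i}) h ∘ from single-⊨-var))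
  (λ p → from (single-⊨-neg {φ = var i}) (not-¬ p ∘ to single-⊨-var))

single-⊨-charConj : ∀ {w v : Val n} → (single w ⊨ charConj v) ⇔ (w ≡ v)
single-⊨-charConj {n} {w} {v} = mk⇔
  (λ h → Pointwise-≡⇒≡ (ext λ i →
    to (single-⊨-lit (lookup v i)) (All.lookup (All.map⁻ (to ⊨-bigAnd h)) (∈-allFin i))))
  (λ { refl → from ⊨-bigAnd (All.map⁺ (All.tabulate {xs = allFin n} λ {i} _ →
                from (single-⊨-lit {v = w} {i = i} (lookup w i)) refl)) })

single-⊨-Θ : ∀ {X : Team n} {w} → (single w ⊨ Θ X) ⇔ (w ∈ X)
single-⊨-Θ {n} {X} {w} = begin
  single w ⊨ Θ X                        ∼⟨ single-⊨-neg-neg ⟩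
  single w ⊨ bigOr (map charConj vs)    ∼⟨ ⊨-bigOr (w , ∈-single w) ⟩
  Any (single w ⊨_) (map charConj vs)   ∼⟨ mk⇔ Any.map⁻ Any.map⁺ ⟩
  Any (λ v → single w ⊨ charConj v) vs  ∼⟨ mk⇔ (Any.map (to single-⊨-charConj))
                                                (Any.map (from single-⊨-charConj)) ⟩
  w ∈ₗ vs                               ∼⟨ ∈-filterᵇ-allVals ⟩
  w ∈ X                                 ∎
  where
  open EquationalReasoning
  vs : List (Val n)
  vs = filterᵇ X (allVals n)

Θ-flat : ∀ (X : Team n) → Flat (Θ X)
Θ-flat {n} X = neg-flat {φ = neg (bigOr (map charConj (filterᵇ X (allVals n))))}

∃-single-⊨? : ∀ (φ : Form n) → Dec (∃ λ v → single v ⊨ φ)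
∃-single-⊨? {n} φ =
  map′ Any.satisfied (λ (v , p) → lose (allVals-complete v) p) (any? (single-⊨? φ) (allVals n))

flat-unsatisfiable⇒≡ᶠbot : Flat φ → (∀ v → ¬ single v ⊨ φ) → φ ≡ᶠ bot
flat-unsatisfiable⇒≡ᶠbot {φ = φ} φ-flat none X =
  mk⇔ (λ h v → ¬-not λ v∈ → none v (to (φ-flat X) h v v∈)) (empty-⊨ φ)

consistent-flat⇒satisfiable : Consistent φ → Flat φ → ∃ λ v → single v ⊨ φ
consistent-flat⇒satisfiable {φ = φ} consistent φ-flat = decidable-stable (∃-single-⊨? φ)
  λ none → consistent (flat-unsatisfiable⇒≡ᶠbot φ-flat λ v p → none (v , p))

flat⇒≡ᶠΘ : Consistent φ → Flat φ → ∃ λ X → NonEmpty X × (φ ≡ᶠ Θ X)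
flat⇒≡ᶠΘ {φ = φ} consistent φ-flat with consistent-flat⇒satisfiable consistent φ-flat
... | v , v⊨φ = ⟦ φ ⟧ , (v , from ∈-⟦⟧ v⊨φ) ,
  flat-≡ᶠ {ψ = Θ ⟦ φ ⟧} φ-flat (Θ-flat ⟦ φ ⟧) λ _ → ⇔-trans (⇔-sym ∈-⟦⟧) (⇔-sym single-⊨-Θ)

flat⇒⊨⊗neg : Flat φ → Valid (φ ⊗ neg φ)
flat⇒⊨⊗neg {φ = φ} φ-flat X =
  X ∩ ⟦ φ ⟧ , X ∖ ⟦ φ ⟧ , ∩-⊆ˡ X ⟦ φ ⟧ , ∖-⊆ X ⟦ φ ⟧ , ∈-∩⊎∈-∖ X ⟦ φ ⟧ ,
  from (φ-flat (X ∩ ⟦ φ ⟧)) (λ v v∈ → to ∈-⟦⟧ (∩-⊆ʳ X ⟦ φ ⟧ v v∈)) ,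
  λ v v∈ → ∈-∖⁻ X ⟦ φ ⟧ v∈ ∘ from ∈-⟦⟧

⊨⊗neg⇒flat : Valid (φ ⊗ neg φ) → Flat φ
⊨⊗neg⇒flat {φ = φ} split = flat-from-singletons λ X all⊨φ → case split X of λ where
  (Y , Z , _ , _ , cover , Y⊨φ , Z⊨¬φ) →
    let X⊆Y : X ⊆ Y
        X⊆Y v v∈ = [ id , (λ v∈Z → ⊥-elim (Z⊨¬φ v v∈Z (all⊨φ v v∈))) ] (cover v v∈)
    in downward-closed φ X⊆Y Y⊨φ

lemma4p1 : ∀ (n : ℕ) (φ : Form n) → Consistent φ →
             (Flat φ ⇔ (∃ λ (X : Team n) → NonEmpty X × (φ ≡ᶠ Θ X)))
           × (Flat φ ⇔ (φ ≡ᶠ neg (neg φ)))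
           × (Flat φ ⇔ Valid (φ ⊗ neg φ))
lemma4p1 n φ consistent =
  mk⇔ (flat⇒≡ᶠΘ consistent) (λ (X , _ , φ≡Θ) → flat-resp-≡ᶠ {ψ = Θ X} φ≡Θ (Θ-flat X)) ,
  mk⇔ (λ φ-flat → flat-≡ᶠ {ψ = ¬¬φ} φ-flat ¬¬φ-flat λ _ → ⇔-sym single-⊨-neg-neg)
      (λ φ≡¬¬φ → flat-resp-≡ᶠ {ψ = ¬¬φ} φ≡¬¬φ ¬¬φ-flat) ,
  mk⇔ flat⇒⊨⊗neg ⊨⊗neg⇒flat
  where
  ¬¬φ : Form n
  ¬¬φ = neg (neg φ)
  ¬¬φ-flat : Flat ¬¬φ
  ¬¬φ-flat = neg-flat {φ = neg φ}
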